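{- Let $V$ be a valuation algebra. (a) If $V$ is memorizing, then $x/(y\bullet x\bullet H)=x/H$ and $x\bullet y\bullet x\bullet H = y\bullet x\bullet H$ for all $H\in V$ and all formulas $x,y$. (b) If $V$ is static, then $x/(y\bullet H)=x/H$ for all $H\in V$ and all formulas $x,y$.
   Context: Fix a set $\mathcal{A}$ of atoms. Formulas: $x ::= \mathrm{T} \mid a \mid \neg x \mid x \mathbin{\triangleleft\wedge} x$ ($a\in\mathcal{A}$). A valuation algebra is a nonempty set $V$ with maps $/:\mathcal{A}\times V\to\{\mathrm{T},\mathrm{F}\}$ and $\bullet:\mathcal{A}\times V\to V$ (infix), extended to formulas by: $\mathrm{T}/H=\mathrm{T}$, $\mathrm{T}\bullet H=H$; $(\neg x)/H=\neg(x/H)$, $(\neg x)\bullet H=x\bullet H$; $(x\mathbin{\triangleleft\wedge}y)/H = y/(x\bullet H)$ if $x/H=\mathrm{T}$, else $\mathrm{F}$; $(x\mathbin{\triangleleft\wedge}y)\bullet H = y\bullet(x\bullet H)$ if $x/H=\mathrm{T}$, else $x\bullet H$. Notation $u\bullet v\bullet H$ means $u\bullet(v\bullet H)$. $V$ is repetition-proof if $a/(a\bullet H)=a/H$ for all $a\in\mathcal{A},H\in V$; contractive if it is repetition-proof and $a\bullet a\bullet H=a\bullet H$; memorizing if it is contractive and $a/(b\bullet a\bullet H)=a/H$, $a\bullet b\bullet a\bullet H=b\bullet a\bullet H$ for all $a,b\in\mathcal{A},H\in V$; static if it is memorizing and $a/(b\bullet H)=a/H$ for all $a,b\in\mathcal{A},H\in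 V$. -}

module Defs where

open import Level using (Level; _⊔_; suc)
open import Data.Bool using (Bool; true; false; not)
open import Relation.Binary.PropositionalEquality using (_≡_)

data Formula {a : Level} (A : Set a) : Set a where
  T     : Formula A
  atom  : A → Formula A
  ¬'_   : Formula A → Formula A
  _◁∧_  : Formula A → Formula A → Formula A

-- Truth values {T, F} are represented by Bool (true = T, false = F).

record ValuationAlgebra {a : Level} (A : Set a) (v : Level) : Set (a ⊔ Level.suc v) where
  field
    V       : Set v
    inhabit : V
    _/ₐ_    : A → V → Bool
    _•ₐ_    : A → V → V

  infixr 5 _•_
  mutual
    _/_ : Formula A → V → Bool
    T / H = true
    atom p / H = p /ₐ H
    (¬' x) / H = not (x / H)
    (x ◁∧ y) / H = condA (x / H) y (x • H)

    _•_ : Formula A → V → V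
    T • H = H
    atom p • H = p •ₐ H
    (¬' x) • H = x • H
    (x ◁∧ y) • H = condB (x / H) y (x • H)

    condA : Bool → Formula A → V → Bool
    condA true  y H' = y / H'
    condA false y H' = false

    condB : Bool → Formula A → V → V
    condB true  y H' = y • H'
    condB false y H' = H'

  RepetitionProof : Set (a ⊔ v)
  RepetitionProof = ∀ (p : A) (H : V) → p /ₐ (p •ₐ H) ≡ p /ₐ H

  Contractive : Set (a ⊔ v)
  Contractive = RepetitionProof × (∀ (p : A) (H : V) → p •ₐ (p •ₐ H) ≡ p •ₐ H)
    where open import Data.Product using (_×_)

  Memorizing : Set (a ⊔ v)
  Memorizing = Contractive
             × (∀ (p q : A) (H : V) → p /ₐ (q •ₐ (p •ₐ H)) ≡ p /ₐ H)
             × (∀ (p q : A) (H : V) → p •ₐ (q •ₐ (p •ₐ H)) ≡ q •ₐ (p •ₐ H))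
    where open import Data.Product using (_×_)

  Static : Set (a ⊔ v)
  Static = Memorizing × (∀ (p q : A) (H : V) → p /ₐ (q •ₐ H) ≡ p /ₐ H)
    where open import Data.Product using (_×_)

-- Both parts are proved by lifting atom-level axioms to formulas along the
-- relation  Reach H K : "K arises from H by finitely many atomic updates".
-- The basic fact is that y • H is reachable from H for every formula y.
--  (a) In a memorizing algebra, every state K reachable from p •ₐ H satisfies
--      p •ₐ K = K and p /ₐ K = p /ₐ H; by induction on x this extends to
--      every state reachable from x • H.  Taking K = y • x • H gives (a).
--  (b) In a static algebra, atomic replies are invariant along Reach, and the
--      reply to a formula only depends on the atomic replies of the state.
--      Since y • H is reachable from H, this gives (b).
module Submission where

open import Defs
open import Level using (Level; _⊔_)
open import Data.Product using (_×_; _,_; proj₁; proj₂)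
open import Data.Bool using (true; false; not)
open import Relation.Binary.PropositionalEquality
  using (_≡_; refl; sym; trans; cong; module ≡-Reasoning)

module Development {a v : Level} {A : Set a} (VA : ValuationAlgebra A v) where
  open ValuationAlgebra VA

  data Reach (H : V) : V → Set (a ⊔ v) where
    here : Reach H H
    step : ∀ p {K} → Reach H K → Reach H (p •ₐ K)

  reach-trans : ∀ {H K L} → Reach H K → Reach K L → Reach H L
  reach-trans r here       = r
  reach-trans r (step p s) = step p (reach-trans r s)

  mutual
    •-reach : ∀ y H → Reach H (y • H)
    •-reach T        H = here
    •-reach (atom p) H = step p here
    •-reach (¬' y)   H = •-reach y H
    •-reach (y ◁∧ z) H = reach-trans (•-reach y H) (condB-reach (y / H) z (y • H))

    condB-reach : ∀ b z H → Reach H (condB b z H)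
    condB-reach true  z H = •-reach z H
    condB-reach false z H = here

  module Memorizing-facts (mem : Memorizing) where
    private
      repetition-proof : ∀ p H → p /ₐ (p •ₐ H) ≡ p /ₐ H
      repetition-proof = proj₁ (proj₁ mem)
      contraction : ∀ p H → p •ₐ (p •ₐ H) ≡ p •ₐ H
      contraction = proj₂ (proj₁ mem)
      memorize-reply : ∀ p q H → p /ₐ (q •ₐ (p •ₐ H)) ≡ p /ₐ H
      memorize-reply = proj₁ (proj₂ mem)
      memorize-effect : ∀ p q H → p •ₐ (q •ₐ (p •ₐ H)) ≡ q •ₐ (p •ₐ H)
      memorize-effect = proj₂ (proj₂ mem)

    atom-memorized : ∀ p H {K} → Reach (p •ₐ H) K →
                     (p /ₐ K ≡ p /ₐ H) × (p •ₐ K ≡ K)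
    atom-memorized p H here = repetition-proof p H , contraction p H
    atom-memorized p H (step q {K} r) with atom-memorized p H r
    ... | reply , absorbed = reply′ , absorbed′
      where
      open ≡-Reasoning
      reply′ : p /ₐ (q •ₐ K) ≡ p /ₐ H
      reply′ = begin
        p /ₐ (q •ₐ K)          ≡⟨ cong (λ L → p /ₐ (q •ₐ L)) (sym absorbed) ⟩
        p /ₐ (q •ₐ (p •ₐ K))   ≡⟨ memorize-reply p q K ⟩
        p /ₐ K                 ≡⟨ reply ⟩
        p /ₐ H                 ∎
      absorbed′ : p •ₐ (q •ₐ K) ≡ q •ₐ K
      absorbed′ = begin
        p •ₐ (q •ₐ K)          ≡⟨ cong (λ L → p •ₐ (q •ₐ L)) (sym absorbed) ⟩
        p •ₐ (q •ₐ (p •ₐ K))   ≡⟨ memorize-effect p q K ⟩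
        q •ₐ (p •ₐ K)          ≡⟨ cong (q •ₐ_) absorbed ⟩
        q •ₐ K                 ∎

    memorized : ∀ x H {K} → Reach (x • H) K → (x / K ≡ x / H) × (x • K ≡ K)
    memorized T        H r = refl , refl
    memorized (atom p) H r = atom-memorized p H r
    memorized (¬' x)   H r with memorized x H r
    ... | reply , absorbed = cong not reply , absorbed
    memorized (x ◁∧ y) H r with x / H in x-reply
    ... | false with memorized x H r
    ...   | reply , absorbed rewrite reply | x-reply = refl , absorbed
    memorized (x ◁∧ y) H r | true
      with memorized x H (reach-trans (•-reach y (x • H)) r) | memorized y (x • H) r
    ... | x-same , x-absorbed | y-same , y-absorbed
      rewrite x-same | x-reply | x-absorbed = y-same , y-absorbed

  module Static-facts (st : Static) where
    private
      static : ∀ p q H → p /ₐ (q •ₐ H) ≡ p /ₐ H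
      static = proj₂ st

    Agree : V → V → Set a
    Agree H K = ∀ p → p /ₐ H ≡ p /ₐ K

    agree-sym : ∀ {H K} → Agree H K → Agree K H
    agree-sym e p = sym (e p)

    agree-trans : ∀ {H K L} → Agree H K → Agree K L → Agree H L
    agree-trans e f p = trans (e p) (f p)

    reach-agree : ∀ {H K} → Reach H K → Agree H K
    reach-agree here           p = refl
    reach-agree (step q {K} r) p = trans (reach-agree r p) (sym (static p q K))

    reply-agree : ∀ x {H K} → Agree H K → x / H ≡ x / K
    reply-agree T        e = refl
    reply-agree (atom p) e = e p
    reply-agree (¬' x)   e = cong not (reply-agree x e)
    reply-agree (x ◁∧ y) {H} {K} e rewrite reply-agree x e with x / K
    ... | true  = reply-agree y (agree-trans (agree-sym (reach-agree (•-reach x H)))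
                                  (agree-trans e (reach-agree (•-reach x K))))
    ... | false = refl

proposition3p8 : ∀ {a v : Level} {A : Set a} (VA : ValuationAlgebra A v) →
    let open ValuationAlgebra VA in
    (Memorizing →
      ((x y : Formula A) (H : V) → x / (y • x • H) ≡ x / H)
      × ((x y : Formula A) (H : V) → x • y • x • H ≡ y • x • H))
    × (Static → (x y : Formula A) (H : V) → x / (y • H) ≡ x / H)
proposition3p8 {A = A} VA = memorizing-part , static-part
  where
  open ValuationAlgebra VA
  open Development VA

  memorizing-part : Memorizing →
      ((x y : Formula A) (H : V) → x / (y • x • H) ≡ x / H)
      × ((x y : Formula A) (H : V) → x • y • x • H ≡ y • x • H)
  memorizing-part mem =
      (λ x y H → proj₁ (memorized x H (•-reach y (x • H))))
    , (λ x y H → proj₂ (memorized x H (•-reach y (x • H))))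
    where open Memorizing-facts mem

  static-part : Static → (x y : Formula A) (H : V) → x / (y • H) ≡ x / H
  static-part st x y H = sym (reply-agree x (reach-agree (•-reach y H)))
    where open Static-facts st
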